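{- Let $G=(V,E,F)$ be a graph with $E\cap F=\emptyset$, and for $x\in V$ let $F(x)=\{x' : (x,x')\in F\}$. Let $u,v\in V$. (1) If $(u,v)\notin E$ and there is a chordless path $u,t_1,\dots,t_k,v$ in $(V,E)$ ($k\ge 1$) with $t_i\in F(u)\cup F(v)$ for every $i=1,\dots,k$, then $(u,v)$ is a forbidden edge. (2) If $(u,v)\in E$ and there is a chordless cycle $u,w,t_1,\dots,t_k,v,u$ in $(V,E)$ ($k\ge1$) with $w\notin F(v)$ and $t_i\in F(u)\cup F(v)$ for every $i=1,\dots,k$, then $(v,w)$ is a forced edge.
   Context: A graph $G=(V,E,F)$ consists of a vertex set $V$, an edge set $E$ of unordered pairs of vertices, and a set $F$ of unordered pairs with $E\cap F=\emptyset$. A graph is chordal if every cycle of length at least $4$ has a chord. A proper chordal completion of $G$ is a chordal graph $(V,E_S)$ with $E\subseteq E_S$ and $E_S\cap F=\emptyset$. For a pair $(x,y)\notin E$ of distinct vertices, $(x,y)$ is a forbidden edge if no proper chordal completion of $G$ contains $(x,y)$ (equivalently, $(x,y)\in F$ or $(V,E\cup\{(x,y)\},F)$ has no proper chordal completion). A pair $(x,y)$ is a forced edge if it belongs to every proper chordal completion of $G$. A path or cycle is chordless if no two nonconsecutive vertices of it are adjacent in $(V,E)$. -}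

module Defs where

open import Data.Nat using (ℕ; zero; suc; _≤_; _+_)
open import Data.Fin using (Fin; toℕ)
open import Data.Product using (Σ; _×_; ∃-syntax)
open import Data.Sum using (_⊎_)
open import Data.Empty using (⊥)
open import Relation.Nullary using (¬_)
open import Relation.Binary.PropositionalEquality using (_≡_; _≢_)
open import Function.Definitions using (Injective)

-- A binary relation on vertices (representing a set of unordered pairs
-- when it is symmetric).
Rel : ℕ → Set₁
Rel n = Fin n → Fin n → Set

Symmetric : ∀ {n} → Rel n → Set
Symmetric R = ∀ x y → R x y → R y x

record Graph : Set₁ where
  field
    n      : ℕ
    E      : Rel n
    F      : Rel n
    E-sym  : Symmetric E
    F-sym  : Symmetric F
    disjEF : ∀ x y → E x y → F x y → ⊥

Consec : ∀ {m} → Fin m → Fin m → Set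
Consec i j = (toℕ j ≡ suc (toℕ i)) ⊎ (toℕ i ≡ suc (toℕ j))

CycConsec : ∀ {m} → Fin m → Fin m → Set
CycConsec {m} i j =
  Consec i j ⊎ ((toℕ i ≡ 0 × suc (toℕ j) ≡ m) ⊎ (toℕ j ≡ 0 × suc (toℕ i) ≡ m))

IsCycle : ∀ {n m} → Rel n → (Fin m → Fin n) → Set
IsCycle R c = Injective _≡_ _≡_ c × (∀ i j → CycConsec i j → R (c i) (c j))

HasChord : ∀ {n m} → Rel n → (Fin m → Fin n) → Set
HasChord R c = ∃[ i ] ∃[ j ] (i ≢ j × ¬ CycConsec i j × R (c i) (c j))

Chordal : ∀ {n} → Rel n → Set
Chordal {n} R = ∀ (m : ℕ) (c : Fin m → Fin n) → 4 ≤ m → IsCycle R c → HasChord R c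

ChordlessPath : ∀ {n m} → Rel n → (Fin m → Fin n) → Set
ChordlessPath R p =
  Injective _≡_ _≡_ p
  × (∀ i j → Consec i j → R (p i) (p j))
  × (∀ i j → i ≢ j → ¬ Consec i j → ¬ R (p i) (p j))

ChordlessCycle : ∀ {n m} → Rel n → (Fin m → Fin n) → Set
ChordlessCycle R c =
  IsCycle R c × (∀ i j → i ≢ j → ¬ CycConsec i j → ¬ R (c i) (c j))

record ProperChordalCompletion (G : Graph) : Set₁ where
  open Graph G
  field
    ES       : Rel n
    ES-sym   : Symmetric ES
    E⊆ES     : ∀ x y → E x y → ES x y
    disjESF  : ∀ x y → ES x y → F x y → ⊥
    chordal  : Chordal ES

ForbiddenEdge : (G : Graph) → Fin (Graph.n G) → Fin (Graph.n G) → Set₁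
ForbiddenEdge G x y =
  x ≢ y × ¬ Graph.E G x y
  × ((S : ProperChordalCompletion G) → ¬ ProperChordalCompletion.ES S x y)

ForcedEdge : (G : Graph) → Fin (Graph.n G) → Fin (Graph.n G) → Set₁
ForcedEdge G x y = (S : ProperChordalCompletion G) → ProperChordalCompletion.ES S x y

module Submission where

-- Both parts of the corollary rest on one classical fact about chordal graphs:
--
--   (Triangle lemma) in a chordal graph, the edge c₀cₗ closing a cycle
--   c₀, c₁, …, cₗ (ℓ ≥ 2) forms a triangle with some inner vertex cⱼ, 0 < j < ℓ.
--
-- For ℓ = 2 take j = 1.  For ℓ ≥ 3 the
-- cycle has a chord cₐc_b (a < b); it is not the closing edge, so deleting the
-- vertices strictly between a and b yields a strictly shorter cycle through c₀cₗ,
-- and a triangle on it is one on the original cycle.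
--
-- For the corollary, let S be a proper chordal completion.  (1) The path
-- u, t₁, …, tₖ, v together with an S-edge uv is a cycle of S, so some tᵢ would
-- be S-adjacent to both u and v, although tᵢ ∈ F(u) ∪ F(v).  (2) The cycle
-- u, w, t₁, …, tₖ, v is a cycle of S closed by uv; its triangle vertex cannot be
-- any tᵢ for the same reason, hence it is w and vw is an edge of S.

open import Defs
open import Data.Nat using (ℕ; zero; suc; _+_; _≤_; _<_; z≤n; s≤s; s≤s⁻¹; _≟_)
open import Data.Nat.Properties
  using (+-cancelʳ-≡; +-identityʳ; +-assoc; +-comm; +-monoˡ-≤; +-monoˡ-<; m≤m+n; m<m+n;
         ≤-refl; ≤-trans; ≤-<-trans; <⇒≤; n<1+n; suc-injective; <-cmp; m≤n⇒∃[o]m+o≡n)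
open import Data.Nat.Induction using (<-rec)
open import Data.Fin using (Fin; zero; suc; toℕ; fromℕ; fromℕ<; inject₁)
open import Data.Fin.Properties using (toℕ-injective; toℕ-fromℕ; toℕ-fromℕ<; toℕ-inject₁; toℕ≤pred[n])
open import Data.Product using (_×_; _,_; ∃-syntax)
open import Data.Sum using (_⊎_; inj₁; inj₂; [_,_])
open import Data.Empty using (⊥-elim)
open import Relation.Nullary using (¬_; yes; no)
open import Relation.Binary.PropositionalEquality
  using (_≡_; _≢_; refl; sym; trans; cong; subst; subst₂; module ≡-Reasoning)
open import Relation.Binary.Definitions using (tri<; tri≈; tri>)
open import Function using (_∘_)
open import Function.Definitions using (Injective)

-- skip a d keeps the indices 0, …, a and shifts the larger ones up by d: it
-- enumerates a sequence with the d entries at positions a+1, …, a+d removed.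
skip : ℕ → ℕ → ℕ → ℕ
skip zero    d zero    = zero
skip zero    d (suc i) = suc (i + d)
skip (suc a) d zero    = zero
skip (suc a) d (suc i) = suc (skip a d i)

skip-zero : ∀ a d → skip a d 0 ≡ 0
skip-zero zero    d = refl
skip-zero (suc a) d = refl

skip-positive : ∀ a d i → 0 < skip a d (suc i)
skip-positive zero    d i = s≤s z≤n
skip-positive (suc a) d i = s≤s z≤n

skip-below : ∀ a d {i} → i ≤ a → skip a d i ≡ i
skip-below a       d z≤n       = skip-zero a d
skip-below (suc a) d (s≤s i≤a) = cong suc (skip-below a d i≤a)

skip-above : ∀ a d {i} → a < i → skip a d i ≡ i + d
skip-above zero    d {suc i} _         = refl
skip-above (suc a) d {suc i} (s≤s a<i) = cong suc (skip-above a d a<i)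

skip-≤ : ∀ a d i → skip a d i ≤ i + d
skip-≤ zero    d zero    = z≤n
skip-≤ zero    d (suc i) = ≤-refl
skip-≤ (suc a) d zero    = z≤n
skip-≤ (suc a) d (suc i) = s≤s (skip-≤ a d i)

skip-injective : ∀ a d {i j} → skip a d i ≡ skip a d j → i ≡ j
skip-injective zero    d {zero}  {zero}  _ = refl
skip-injective zero    d {suc i} {suc j} e = cong suc (+-cancelʳ-≡ d i j (suc-injective e))
skip-injective (suc a) d {zero}  {zero}  _ = refl
skip-injective (suc a) d {suc i} {suc j} e = cong suc (skip-injective a d (suc-injective e))

skip-step : ∀ a d i → i ≢ a → skip a d (suc i) ≡ suc (skip a d i)
skip-step zero    d zero    i≢a = ⊥-elim (i≢a refl)
skip-step zero    d (suc i) _   = refl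
skip-step (suc a) d zero    _   = cong suc (skip-zero a d)
skip-step (suc a) d (suc i) i≢a = cong suc (skip-step a d i (i≢a ∘ cong suc))

-- A chord from a to b of a cycle with last index ℓ that is neither a cycle edge
-- nor the closing edge splits as b = a + 1 + d, ℓ = ℓ' + d with 1 ≤ d, a < ℓ' and
-- 2 ≤ ℓ': removing the d vertices strictly between a and b leaves a cycle with
-- last index ℓ'.
data ChordSplit : ℕ → ℕ → ℕ → Set where
  split : ∀ {a} ℓ' d → a < ℓ' → 2 ≤ ℓ' → 1 ≤ d → ChordSplit (ℓ' + d) a (suc a + d)

chord-split : ∀ {ℓ a b} → a < b → b ≤ ℓ → b ≢ suc a → (a ≡ 0 → b ≢ ℓ) → ChordSplit ℓ a b
chord-split {a = a} a<b b≤ℓ b≢1+a not-closing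
  with m≤n⇒∃[o]m+o≡n a<b | m≤n⇒∃[o]m+o≡n b≤ℓ
... | d , refl | r , refl =
  subst (λ ℓ → ChordSplit ℓ a (suc a + d)) rearrange
    (split (suc a + r) d (s≤s (m≤m+n a r)) (long-remainder a r not-closing) (gap-nonempty d b≢1+a))
  where
    open ≡-Reasoning
    rearrange : suc a + r + d ≡ suc a + d + r
    rearrange = begin
      suc a + r + d   ≡⟨ +-assoc (suc a) r d ⟩
      suc a + (r + d) ≡⟨ cong (suc a +_) (+-comm r d) ⟩
      suc a + (d + r) ≡⟨ sym (+-assoc (suc a) d r) ⟩
      suc a + d + r   ∎
    gap-nonempty : ∀ x → suc a + x ≢ suc a → 1 ≤ x
    gap-nonempty zero    ne = ⊥-elim (ne (+-identityʳ (suc a)))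
    gap-nonempty (suc x) _  = s≤s z≤n
    long-remainder : ∀ a' r' {x} → (a' ≡ 0 → x ≢ x + r') → 2 ≤ suc a' + r'
    long-remainder (suc a') r'       _          = s≤s (s≤s z≤n)
    long-remainder zero     (suc r') _          = s≤s (s≤s z≤n)
    long-remainder zero     zero     ends-apart = ⊥-elim (ends-apart refl (sym (+-identityʳ _)))

module _ {n : ℕ} (R : Rel n) where

  -- A cycle c 0, c 1, …, c ℓ, c 0 given as an ℕ-indexed vertex sequence (only the
  -- positions 0, …, ℓ matter).  This form makes deleting vertices a reindexing.
  record IsSeqCycle (ℓ : ℕ) (c : ℕ → Fin n) : Set where
    field
      distinct : ∀ {i j} → i ≤ ℓ → j ≤ ℓ → c i ≡ c j → i ≡ j
      adjacent : ∀ {i} → i < ℓ → R (c i) (c (suc i))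
      closing  : R (c 0) (c ℓ)

  ClosingTriangle : ℕ → (ℕ → Fin n) → Set
  ClosingTriangle ℓ c = ∃[ j ] (0 < j × j < ℓ × R (c 0) (c j) × R (c ℓ) (c j))

  shortcut : ∀ {ℓ' d a c} → IsSeqCycle (ℓ' + d) c → a < ℓ' → R (c a) (c (suc a + d)) →
             IsSeqCycle ℓ' (c ∘ skip a d)
  shortcut {ℓ'} {d} {a} {c} cyc a<ℓ' chord = record
    { distinct = λ i≤ℓ' j≤ℓ' eq →
        skip-injective a d (distinct (stays-in i≤ℓ') (stays-in j≤ℓ') eq)
    ; adjacent = step
    ; closing  = subst₂ (λ x y → R (c x) (c y))
                   (sym (skip-zero a d)) (sym (skip-above a d a<ℓ')) closing
    }
    where
      open IsSeqCycle cyc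
      stays-in : ∀ {i} → i ≤ ℓ' → skip a d i ≤ ℓ' + d
      stays-in {i} i≤ℓ' = ≤-trans (skip-≤ a d i) (+-monoˡ-≤ d i≤ℓ')
      step : ∀ {i} → i < ℓ' → R (c (skip a d i)) (c (skip a d (suc i)))
      step {i} i<ℓ' with i ≟ a
      ... | yes refl = subst₂ (λ x y → R (c x) (c y))
                         (sym (skip-below a d ≤-refl)) (sym (skip-above a d (n<1+n a))) chord
      ... | no i≢a   = subst (λ y → R (c (skip a d i)) (c y)) (sym (skip-step a d i i≢a))
                         (adjacent (≤-<-trans (skip-≤ a d i) (+-monoˡ-< d i<ℓ')))

  shortcut-triangle : ∀ {ℓ' d a c} → a < ℓ' →
                      ClosingTriangle ℓ' (c ∘ skip a d) → ClosingTriangle (ℓ' + d) c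
  shortcut-triangle {ℓ'} {d} {a} {c} a<ℓ' (suc j , _ , j<ℓ' , first , last) =
      skip a d (suc j)
    , skip-positive a d j
    , ≤-<-trans (skip-≤ a d (suc j)) (+-monoˡ-< d j<ℓ')
    , subst (λ x → R (c x) (c (skip a d (suc j)))) (skip-zero a d) first
    , subst (λ x → R (c x) (c (skip a d (suc j)))) (skip-above a d a<ℓ') last

-- A Fin-indexed sequence read as an ℕ-indexed one (constant past the end).
extend : ∀ {A : Set} {ℓ} → (Fin (suc ℓ) → A) → ℕ → A
extend {ℓ = zero}  c _       = c zero
extend {ℓ = suc ℓ} c zero    = c zero
extend {ℓ = suc ℓ} c (suc i) = extend (c ∘ suc) i

extend-toℕ : ∀ {A : Set} {ℓ} (c : Fin (suc ℓ) → A) (x : Fin (suc ℓ)) → extend c (toℕ x) ≡ c x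
extend-toℕ {ℓ = zero}  c zero    = refl
extend-toℕ {ℓ = suc ℓ} c zero    = refl
extend-toℕ {ℓ = suc ℓ} c (suc x) = extend-toℕ (c ∘ suc) x

extend-at : ∀ {A : Set} {ℓ i} (c : Fin (suc ℓ) → A) (i≤ℓ : i ≤ ℓ) → extend c i ≡ c (fromℕ< (s≤s i≤ℓ))
extend-at c i≤ℓ = trans (cong (extend c) (sym (toℕ-fromℕ< (s≤s i≤ℓ)))) (extend-toℕ c _)

extend-last : ∀ {A : Set} {ℓ} (c : Fin (suc ℓ) → A) → extend c ℓ ≡ c (fromℕ ℓ)
extend-last {ℓ = ℓ} c = trans (cong (extend c) (sym (toℕ-fromℕ ℓ))) (extend-toℕ c (fromℕ ℓ))

module _ {n : ℕ} (R : Rel n) (R-sym : Symmetric R) where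

  seq→cycle : ∀ {ℓ c} → IsSeqCycle R ℓ c → IsCycle R (λ (x : Fin (suc ℓ)) → c (toℕ x))
  seq→cycle {ℓ} {c} cyc =
    (λ {x} {y} eq → toℕ-injective (distinct (toℕ≤pred[n] x) (toℕ≤pred[n] y) eq)) , edge
    where
      open IsSeqCycle cyc
      edge : ∀ (x y : Fin (suc ℓ)) → CycConsec x y → R (c (toℕ x)) (c (toℕ y))
      edge x y (inj₁ (inj₁ y≡1+x)) rewrite y≡1+x =
        adjacent (subst (_≤ ℓ) y≡1+x (toℕ≤pred[n] y))
      edge x y (inj₁ (inj₂ x≡1+y)) rewrite x≡1+y =
        R-sym _ _ (adjacent (subst (_≤ ℓ) x≡1+y (toℕ≤pred[n] x)))
      edge x y (inj₂ (inj₁ (x≡0 , y≡ℓ))) rewrite x≡0 | suc-injective y≡ℓ = closing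
      edge x y (inj₂ (inj₂ (y≡0 , x≡ℓ))) rewrite y≡0 | suc-injective x≡ℓ = R-sym _ _ closing

  cycle→seq : ∀ {ℓ} {c : Fin (suc ℓ) → Fin n} → IsCycle R c → IsSeqCycle R ℓ (extend c)
  cycle→seq {ℓ} {c} (c-inj , edge) = record
    { distinct = distinct
    ; adjacent = λ {i} i<ℓ →
        subst₂ R (sym (extend-at c (<⇒≤ i<ℓ))) (sym (extend-at c i<ℓ))
          (edge _ _ (inj₁ (inj₁ (trans (toℕ-fromℕ< (s≤s i<ℓ)) (cong suc (sym (toℕ-fromℕ< (s≤s (<⇒≤ i<ℓ)))))))))
    ; closing  =
        subst₂ R (sym (extend-toℕ c zero)) (sym (extend-last c))
          (edge zero (fromℕ ℓ) (inj₂ (inj₁ (refl , cong suc (toℕ-fromℕ ℓ)))))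
    }
    where
      open ≡-Reasoning
      distinct : ∀ {i j} → i ≤ ℓ → j ≤ ℓ → extend c i ≡ extend c j → i ≡ j
      distinct {i} {j} i≤ℓ j≤ℓ eq = begin
        i                        ≡⟨ sym (toℕ-fromℕ< (s≤s i≤ℓ)) ⟩
        toℕ (fromℕ< (s≤s i≤ℓ))   ≡⟨ cong toℕ (c-inj (trans (sym (extend-at c i≤ℓ)) (trans eq (extend-at c j≤ℓ)))) ⟩
        toℕ (fromℕ< (s≤s j≤ℓ))   ≡⟨ toℕ-fromℕ< (s≤s j≤ℓ) ⟩
        j                        ∎

  module _ (chordal : Chordal R) where

    seq-chord : ∀ {ℓ c} → 3 ≤ ℓ → IsSeqCycle R ℓ c →
                ∃[ a ] ∃[ b ] (ChordSplit ℓ a b × R (c a) (c b))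
    seq-chord {ℓ} {c} 3≤ℓ cyc
      with chordal (suc ℓ) (λ (x : Fin (suc ℓ)) → c (toℕ x)) (s≤s 3≤ℓ) (seq→cycle cyc)
    ... | x , y , x≢y , not-consec , chord with <-cmp (toℕ x) (toℕ y)
    ... | tri< x<y _ _ =
      toℕ x , toℕ y ,
      chord-split x<y (toℕ≤pred[n] y) (not-consec ∘ inj₁ ∘ inj₁)
        (λ x≡0 y≡ℓ → not-consec (inj₂ (inj₁ (x≡0 , cong suc y≡ℓ)))) ,
      chord
    ... | tri≈ _ x≡y _ = ⊥-elim (x≢y (toℕ-injective x≡y))
    ... | tri> _ _ y<x =
      toℕ y , toℕ x ,
      chord-split y<x (toℕ≤pred[n] x) (not-consec ∘ inj₁ ∘ inj₂)
        (λ y≡0 x≡ℓ → not-consec (inj₂ (inj₂ (y≡0 , cong suc x≡ℓ)))) ,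
      R-sym _ _ chord

    seq-triangle : ∀ ℓ → 2 ≤ ℓ → ∀ c → IsSeqCycle R ℓ c → ClosingTriangle R ℓ c
    seq-triangle = <-rec Triangle step
      where
        Triangle : ℕ → Set
        Triangle ℓ = 2 ≤ ℓ → ∀ c → IsSeqCycle R ℓ c → ClosingTriangle R ℓ c

        along-chord : ∀ {ℓ a b c} → (∀ {ℓ'} → ℓ' < ℓ → Triangle ℓ') →
                      IsSeqCycle R ℓ c → ChordSplit ℓ a b → R (c a) (c b) →
                      ClosingTriangle R ℓ c
        along-chord IH cyc (split ℓ' d a<ℓ' 2≤ℓ' 1≤d) chord =
          shortcut-triangle R a<ℓ'
            (IH (m<m+n ℓ' 1≤d) 2≤ℓ' _ (shortcut R cyc a<ℓ' chord))

        step : ∀ ℓ → (∀ {ℓ'} → ℓ' < ℓ → Triangle ℓ') → Triangle ℓ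
        step 1 _ (s≤s ())
        step 2 _ _ c cyc =
          1 , s≤s z≤n , s≤s (s≤s z≤n) , adjacent (s≤s z≤n) , R-sym _ _ (adjacent (s≤s (s≤s z≤n)))
          where open IsSeqCycle cyc
        step (suc (suc (suc m))) IH _ c cyc with seq-chord (s≤s (s≤s (s≤s z≤n))) cyc
        ... | a , b , splitting , chord = along-chord IH cyc splitting chord

    closing-edge-triangle : ∀ m → 1 ≤ m → (c : Fin (suc (suc m)) → Fin n) → IsCycle R c →
      ∃[ t ] (R (c zero) (c (suc (inject₁ t))) × R (c (fromℕ (suc m))) (c (suc (inject₁ t))))
    closing-edge-triangle m 1≤m c cyc
      with seq-triangle (suc m) (s≤s 1≤m) (extend c) (cycle→seq cyc)
    ... | suc j , _ , 1+j<1+m , first , last =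
        t
      , subst₂ R (extend-toℕ c zero) at-t first
      , subst₂ R (extend-last c) at-t last
      where
        t : Fin m
        t = fromℕ< (s≤s⁻¹ 1+j<1+m)
        at-t : extend c (suc j) ≡ c (suc (inject₁ t))
        at-t = trans (cong (extend c ∘ suc) (sym (trans (toℕ-inject₁ t) (toℕ-fromℕ< _))))
                     (extend-toℕ c (suc (inject₁ t)))

IsCycle-mono : ∀ {n m} {R S : Rel n} {c : Fin m → Fin n} →
               (∀ x y → R x y → S x y) → IsCycle R c → IsCycle S c
IsCycle-mono R⊆S (c-inj , edge) = c-inj , λ i j ij → R⊆S _ _ (edge i j ij)

path-cycle : ∀ {n ℓ} {R : Rel n} {p : Fin (suc ℓ) → Fin n} → Symmetric R →
             Injective _≡_ _≡_ p → (∀ i j → Consec i j → R (p i) (p j)) →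
             R (p zero) (p (fromℕ ℓ)) → IsCycle R p
path-cycle {ℓ = ℓ} {R} {p} R-sym p-inj edge closing = p-inj , cycle-edge
  where
    is-last : ∀ {j} → suc (toℕ j) ≡ suc ℓ → j ≡ fromℕ ℓ
    is-last j≡ℓ = toℕ-injective (trans (suc-injective j≡ℓ) (sym (toℕ-fromℕ ℓ)))
    cycle-edge : ∀ i j → CycConsec i j → R (p i) (p j)
    cycle-edge i j (inj₁ ij) = edge i j ij
    cycle-edge i j (inj₂ (inj₁ (i≡0 , j≡ℓ))) =
      subst₂ (λ x y → R (p x) (p y)) (sym (toℕ-injective i≡0)) (sym (is-last j≡ℓ)) closing
    cycle-edge i j (inj₂ (inj₂ (j≡0 , i≡ℓ))) =
      subst₂ (λ x y → R (p x) (p y)) (sym (is-last i≡ℓ)) (sym (toℕ-injective j≡0)) (R-sym _ _ closing)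

ends-distinct : ∀ {A : Set} {k} {p : Fin (suc (suc k)) → A} {u v} →
                Injective _≡_ _≡_ p → p zero ≡ u → p (fromℕ (suc k)) ≡ v → u ≢ v
ends-distinct p-inj refl refl u≡v with p-inj u≡v
... | ()

module _ {G : Graph} (S : ProperChordalCompletion G) where
  open Graph G
  open ProperChordalCompletion S

  common-neighbour-allowed : ∀ {x y t} → ES x t → ES y t → ¬ (F x t ⊎ F y t)
  common-neighbour-allowed xt yt = [ disjESF _ _ xt , disjESF _ _ yt ]

  ends-not-joined : ∀ k → 1 ≤ k → {u v : Fin n} (p : Fin (suc (suc k)) → Fin n) →
    Injective _≡_ _≡_ p → (∀ i j → Consec i j → E (p i) (p j)) →
    p zero ≡ u → p (fromℕ (suc k)) ≡ v →
    ((i : Fin k) → F u (p (suc (inject₁ i))) ⊎ F v (p (suc (inject₁ i)))) →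
    ¬ ES u v
  ends-not-joined k 1≤k p p-inj p-edge refl refl inner-F uv =
    let cycle = path-cycle ES-sym p-inj (λ i j ij → E⊆ES _ _ (p-edge i j ij)) uv
        (t , ut , vt) = closing-edge-triangle ES ES-sym chordal k 1≤k p cycle
    in common-neighbour-allowed ut vt (inner-F t)

  -- Part (2): in an E-cycle u, w, t₁, …, tₖ, v with every tᵢ in F(u) ∪ F(v), the
  -- only possible triangle vertex on the edge uv is w, so S contains vw.
  second-vertex-joined : ∀ k {u v w : Fin n} (c : Fin (suc (suc (suc k))) → Fin n) →
    IsCycle E c → c zero ≡ u → c (suc zero) ≡ w → c (fromℕ (suc (suc k))) ≡ v →
    ((i : Fin k) → F u (c (suc (suc (inject₁ i)))) ⊎ F v (c (suc (suc (inject₁ i))))) →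
    ES v w
  second-vertex-joined k c cycle refl refl refl inner-F
    with closing-edge-triangle ES ES-sym chordal (suc k) (s≤s z≤n) c (IsCycle-mono E⊆ES cycle)
  ... | zero  , _  , vw = vw
  ... | suc t , ut , vt = ⊥-elim (common-neighbour-allowed ut vt (inner-F t))

corollary1 : (G : Graph) → let open Graph G in (u v : Fin n) →
    ((k : ℕ) → 1 ≤ k → ¬ E u v →
      (p : Fin (suc (suc k)) → Fin n) → ChordlessPath E p →
      p zero ≡ u → p (fromℕ (suc k)) ≡ v →
      ((i : Fin k) → F u (p (suc (inject₁ i))) ⊎ F v (p (suc (inject₁ i)))) →
      ForbiddenEdge G u v)
    ×
    ((k : ℕ) → 1 ≤ k → E u v → (w : Fin n) → ¬ F v w →
      (c : Fin (suc (suc (suc k))) → Fin n) → ChordlessCycle E c →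
      c zero ≡ u → c (suc zero) ≡ w → c (fromℕ (suc (suc k))) ≡ v →
      ((i : Fin k) → F u (c (suc (suc (inject₁ i)))) ⊎ F v (c (suc (suc (inject₁ i))))) →
      ForcedEdge G v w)
corollary1 G u v =
    (λ k 1≤k ¬uv p (p-inj , p-edge , _) p₀ pₗ inner-F →
         ends-distinct p-inj p₀ pₗ
       , ¬uv
       , λ S → ends-not-joined S k 1≤k p p-inj p-edge p₀ pₗ inner-F)
  , (λ k _ _ w _ c (cycle , _) c₀ c₁ cₗ inner-F S →
         second-vertex-joined S k c cycle c₀ c₁ cₗ inner-F)
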